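{- Assume $\mathbf{At}_T$ is finitely ranked and let $\theta(x)$ be a complete pseudo-minimal formula. Let $\overline{c}^*,\overline{c},\overline{c}'$ be finite tuples from $\theta(N)$ and $b,h,b'$ finite tuples from $N$ such that: (1) $\overline{c}$ $\theta$-dominates $b$ over $h$; (2) $\overline{c}^*\overline{c}$ is independent over $h$; (3) $\overline{c}'$ is independent over $\overline{c}^*h\overline{c}b$; and (4) $\mathrm{tp}(\overline{c}'b'/h)=\mathrm{tp}(\overline{c}b/h)$. Then $\overline{c}^*$ is independent over $h\overline{c}b\overline{c}'b'$.
   Context: $T$ is a complete first-order theory in a countable language, $\mathbf{At}_T$ its class of atomic models, $N$ a countable atomic model of $T$ that is not minimal; all tuples are finite from $N$. $d\in\mathrm{pcl}(a)$ means every $M\preceq N$ containing $a$ contains $d$. $\mathrm{tp}(d/a)$ is pseudo-minimal if $d\notin\mathrm{pcl}(a)$ and for all finite $b,c$, if $c\in\mathrm{pcl}(abd)\setminus\mathrm{pcl}(ab)$ then $d\in\mathrm{pcl}(abc)$. A complete pseudo-minimal formula $\theta(x)$ is one isolating a pseudo-minimal type in $S_{at}(\emptyset)$; a tuple $(c_1,\dots,c_n)$ from $\theta(N)$ is independent over $a$ if $c_i\notin\mathrm{pcl}(a\cup\{c_j:j\ne i\})$ for all $i$. $S_{at}(a)$ is the set of complete types over $a$ realized in $N$. Rank: $\mathrm{rk}(d/a)\ge0$; for $\alpha>0$, $\mathrm{rk}(d/a)\ge\alpha$ iff for every $r\in S_{at}(a)$ and $\beta<\alpha$ there are finite $a',b,c$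 with $\mathrm{tp}(a'/a)=r$, $\mathrm{rk}(d/aa'bc)\ge\beta$, $c\in\mathrm{pcl}(daa'b)\setminus\mathrm{pcl}(aa'b)$. $\mathbf{At}_T$ is finitely ranked if all $\mathrm{rk}(d/a)<\omega$. $\overline{c}$ $\theta$-dominates $b$ over $h$ if $\overline{c}$ is independent over $h$ and for every finite tuple $\overline{c}^{**}$ from $\theta(N)$ and every finite $h^{**}\supseteq h$, if $\overline{c}\,\overline{c}^{**}$ is independent over $h^{**}$ then $\overline{c}^{**}$ is independent over $h^{**}\overline{c}b$. -}

module Defs where

open import Level using (Level; 0ℓ; Lift) renaming (suc to lsuc)
open import Data.Unit using (⊤)
open import Data.Nat using (ℕ; zero; suc; _+_; _*_)
open import Data.Fin using (Fin; _≟_)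
open import Data.Vec using (Vec; []; _∷_; _++_; lookup; map; concat; toList)
open import Data.Vec.Relation.Unary.All as VAll using (All; []; _∷_)
open import Data.List as List using (List)
import Data.List.Relation.Unary.All as LAll
open import Data.List.Membership.Propositional using (_∈_)
open import Data.Product using (Σ; ∃; ∃-syntax; _×_; _,_; proj₁; proj₂)
open import Data.Sum using (_⊎_)
open import Data.Empty using (⊥)
open import Relation.Nullary using (¬_; yes; no)
open import Relation.Binary.PropositionalEquality using (_≡_)
open import Function.Definitions using (Injective; Surjective)

record Language : Set₁ where
  field
    Fn     : ℕ → Set
    Rl     : ℕ → Set
    Fn-enc : ∀ m → Σ (Fn m → ℕ) (λ e → Injective _≡_ _≡_ e)
    Rl-enc : ∀ m → Σ (Rl m → ℕ) (λ e → Injective _≡_ _≡_ e)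
open Language public

-- Syntax: terms and formulas in n free variables (de Bruijn, Fin n)

data Term (L : Language) (n : ℕ) : Set where
  var : Fin n → Term L n
  app : ∀ {m} → Fn L m → Vec (Term L n) m → Term L n

data Formula (L : Language) : ℕ → Set where
  ⊥'   : ∀ {n} → Formula L n
  _≐_  : ∀ {n} → Term L n → Term L n → Formula L n
  rel  : ∀ {n m} → Rl L m → Vec (Term L n) m → Formula L n
  ¬'_  : ∀ {n} → Formula L n → Formula L n
  _∧'_ : ∀ {n} → Formula L n → Formula L n → Formula L n
  _∨'_ : ∀ {n} → Formula L n → Formula L n → Formula L n
  _⇒'_ : ∀ {n} → Formula L n → Formula L n → Formula L n
  ∃'   : ∀ {n} → Formula L (suc n) → Formula L n
  ∀'   : ∀ {n} → Formula L (suc n) → Formula L n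

record Structure (L : Language) : Set₁ where
  field
    Carrier : Set
    fn : ∀ {m} → Fn L m → Vec Carrier m → Carrier
    rl : ∀ {m} → Rl L m → Vec Carrier m → Set
open Structure public

module _ {L : Language} (N : Structure L) where
  mutual
    evalT : ∀ {n} → Term L n → Vec (Carrier N) n → Carrier N
    evalT (var i)    v = lookup v i
    evalT (app f ts) v = fn N f (evalTs ts v)

    evalTs : ∀ {n m} → Vec (Term L n) m → Vec (Carrier N) n → Vec (Carrier N) m
    evalTs []       v = []
    evalTs (t ∷ ts) v = evalT t v ∷ evalTs ts v

  Sat : ∀ {n} → Formula L n → Vec (Carrier N) n → Set
  Sat ⊥'         v = ⊥
  Sat (s ≐ t)    v = evalT s v ≡ evalT t v
  Sat (rel r ts) v = rl N r (evalTs ts v)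
  Sat (¬' φ)     v = ¬ Sat φ v
  Sat (φ ∧' ψ)   v = Sat φ v × Sat ψ v
  Sat (φ ∨' ψ)   v = Sat φ v ⊎ Sat ψ v
  Sat (φ ⇒' ψ)   v = Sat φ v → Sat ψ v
  Sat (∃' φ)     v = Σ (Carrier N) (λ a → Sat φ (a ∷ v))
  Sat (∀' φ)     v = (a : Carrier N) → Sat φ (a ∷ v)

  ClosedUnderFns : (Carrier N → Set) → Set
  ClosedUnderFns P = ∀ {m} (f : Fn L m) (v : Vec (Carrier N) m) → All P v → P (fn N f v)

  allProj : {P : Carrier N → Set} {m : ℕ} (v : Vec (Σ (Carrier N) P) m) → All P (map proj₁ v)
  allProj []       = []
  allProj (x ∷ v) = proj₂ x ∷ allProj v

  subStructure : (P : Carrier N → Set) → ClosedUnderFns P → Structure L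
  subStructure P cl = record
    { Carrier = Σ (Carrier N) P
    ; fn = λ f v → fn N f (map proj₁ v) , cl f (map proj₁ v) (allProj v)
    ; rl = λ r v → rl N r (map proj₁ v) }

module Notions {L : Language} (N : Structure L) where
  private A = Carrier N

  -- P (the domain of M) is the universe of an elementary substructure M ≼ N
  IsElemSub : (A → Set) → Set
  IsElemSub P = Σ (ClosedUnderFns N P) λ cl →
    ∀ {n} (φ : Formula L n) (v : Vec (Σ A P) n) →
      (Sat (subStructure N P cl) φ v → Sat N φ (map proj₁ v)) ×
      (Sat N φ (map proj₁ v) → Sat (subStructure N P cl) φ v)

  -- "d ∈ pcl(a)": every M ≼ N containing a contains d (tuples as lists)
  InPcl : List A → List A → Set₁
  InPcl d a = ∀ (P : A → Set) → IsElemSub P → LAll.All P a → LAll.All P d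

  SameTp : ∀ {m l} → Vec A m → Vec A m → Vec A l → Set
  SameTp {m} {l} d d' a = ∀ (φ : Formula L (m + l)) →
    (Sat N φ (d ++ a) → Sat N φ (d' ++ a)) × (Sat N φ (d' ++ a) → Sat N φ (d ++ a))

  -- φ isolates tp(d) (over ∅) in T = Th(N): T ⊢ φ → ψ for every ψ ∈ tp(d)
  Isolates : ∀ {m} → Formula L m → Vec A m → Set
  Isolates φ d = Sat N φ d × (∀ (ψ : Formula L _) → Sat N ψ d → ∀ x → Sat N φ x → Sat N ψ x)

  Countable : Set
  Countable = Σ (ℕ → A) λ f → Surjective _≡_ _≡_ f

  Atomic : Set
  Atomic = ∀ {m} (d : Vec A m) → Σ (Formula L m) λ φ → Isolates φ d

  NotMinimal : Set₁
  NotMinimal = Σ (A → Set) λ P → IsElemSub P × Σ A (λ x → ¬ P x)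

  PseudoMinimal : ∀ {m l} → Vec A m → Vec A l → Set₁
  PseudoMinimal d a =
    ¬ InPcl (toList d) (toList a) ×
    (∀ (b c : List A) →
       InPcl c (toList a List.++ b List.++ toList d) →
       ¬ InPcl c (toList a List.++ b) →
       InPcl (toList d) (toList a List.++ b List.++ c))

  -- θ is a complete pseudo-minimal formula: it isolates a type in S_at(∅)
  -- (a type realized in N) which is pseudo-minimal
  CompletePseudoMinimal : ∀ {k} → Formula L k → Set₁
  CompletePseudoMinimal θ = Σ (Vec A _) λ e → Isolates θ e × PseudoMinimal e []

  -- Rank.  Step R d a: for every r = tp(e/a) ∈ S_at(a) there are a', b, c
  -- with tp(a'/a) = r, R d (a a' b c), c ∈ pcl(d a a' b) \ pcl(a a' b).
  Step : (∀ {p l} → Vec A p → Vec A l → Set₁) → ∀ {p l} → Vec A p → Vec A l → Set₁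
  Step R {p} {l} d a = ∀ {m} (e : Vec A m) →
    Σ (Vec A m) λ a' → Σ ℕ λ lb → Σ (Vec A lb) λ b → Σ ℕ λ lc → Σ (Vec A lc) λ c →
      SameTp a' e a ×
      R d (a ++ a' ++ b ++ c) ×
      InPcl (toList c) (toList (d ++ a ++ a' ++ b)) ×
      ¬ InPcl (toList c) (toList (a ++ a' ++ b))

  -- RkGe n d a  ⇔  rk(d/a) ≥ n.  RkGe (suc n) = ⋀_{β ≤ n} Step (RkGe β),
  -- which is exactly the clause "for every β < n+1 ..." of the definition.
  RkGe : ℕ → ∀ {p l} → Vec A p → Vec A l → Set₁
  RkGe zero    d a = Lift (lsuc 0ℓ) ⊤
  RkGe (suc n) d a = RkGe n d a × Step (RkGe n) d a

  -- every rk(d/a) < ω, i.e. is some natural number n (so rk(d/a) ≱ n+1)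
  FinitelyRanked : Set₁
  FinitelyRanked = ∀ {p l} (d : Vec A p) (a : Vec A l) → Σ ℕ λ n → ¬ RkGe n d a

  Inθ : ∀ {k n} → Formula L k → Vec (Vec A k) n → Set
  Inθ θ cs = All (Sat N θ) cs

  others : ∀ {k n} → Vec (Vec A k) n → Fin n → List A
  others {n = n} cs i = List.concat (List.map pick (List.allFin n))
    where
    pick : Fin n → List A
    pick j with j ≟ i
    ... | yes _ = List.[]
    ... | no  _ = toList (lookup cs j)

  Indep : ∀ {k n} → Vec (Vec A k) n → List A → Set₁
  Indep cs a = ∀ i → ¬ InPcl (toList (lookup cs i)) (a List.++ others cs i)

  flat : ∀ {k n} → Vec (Vec A k) n → List A
  flat cs = toList (concat cs)

  Dominates : ∀ {k n lb lh} → Formula L k → Vec (Vec A k) n → Vec A lb → Vec A lh → Set₁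
  Dominates {k} θ cs b h =
    Indep cs (toList h) ×
    (∀ {m} (cs** : Vec (Vec A k) m) → Inθ θ cs** →
     ∀ (h** : List A) → (∀ {x} → x ∈ toList h → x ∈ h**) →
     Indep (cs ++ cs**) h** →
     Indep cs** (h** List.++ flat cs List.++ toList b))

-- Domination of b by c̄ over h, applied to c̄*, makes c̄* independent over h c̄ b. A countable
-- atomic model is homogeneous, so tp(c̄'b'/h) = tp(c̄b/h) is realised by an automorphism fixing h;
-- automorphisms preserve pcl, hence c̄' θ-dominates b' over h. Transporting the pseudo-minimality
-- of θ along automorphisms gives exchange for every realisation of θ, and with it c̄' c̄* is
-- independent over h c̄ b. Domination by c̄' then gives the claim.

module Submission where

open import Defs
open import Level using (0ℓ; Lift; lift; lower) renaming (suc to lsuc)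
open import Axiom.ExcludedMiddle using (ExcludedMiddle)
open import Axiom.UniquenessOfIdentityProofs using (module Decidable⇒UIP)
open import Data.Nat using (ℕ; zero; suc; _+_; _⊔_; _≤′_; ≤′-reflexive; ≤′-step)
open import Data.Nat.Properties using (≤⇒≤′; m≤m⊔n; m≤n⊔m)
open import Data.Fin as Fin using (Fin; _≟_; _↑ˡ_; _↑ʳ_)
import Data.Fin.Properties as FinP
open import Data.Vec using (Vec; []; _∷_; _++_; concat; toList; map; lookup)
import Data.Vec.Properties as VecP
open import Data.Vec.Relation.Unary.All as VAll using (All; []; _∷_)
import Data.Vec.Relation.Unary.All.Properties as VAllP
open import Data.List as List using (List)
import Data.List.Properties as ListP
import Data.List.Relation.Unary.All.Properties as LAllP
open import Data.List.Relation.Unary.Any using (here; there)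
open import Data.List.Membership.Propositional using (_∈_)
open import Data.List.Membership.Propositional.Properties
open import Data.List.Relation.Binary.Subset.Propositional using (_⊆_)
open import Data.List.Relation.Binary.Subset.Propositional.Properties
open import Data.Product using (Σ; ∃; _×_; _,_; proj₁; proj₂)
open import Data.Product.Properties using (,-injectiveʳ-UIP)
open import Data.Sum using (inj₁; inj₂)
open import Data.Empty using (⊥-elim)
open import Function using (_∘_)
open import Relation.Nullary using (¬_; Dec; yes; no)
import Relation.Nullary.Decidable as Dec
open import Relation.Binary.PropositionalEquality

decide : ExcludedMiddle (lsuc 0ℓ) → (P : Set) → Dec P
decide lem P = Dec.map′ lower lift lem

map-inverse : ∀ {A B : Set} {f : B → A} {g : A → B} → (∀ x → f (g x) ≡ x) →
              ∀ {n} (v : Vec A n) → map f (map g v) ≡ v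
map-inverse fg []      = refl
map-inverse fg (x ∷ v) = cong₂ _∷_ (fg x) (map-inverse fg v)

List-map-inverse : ∀ {A B : Set} {f : B → A} {g : A → B} → (∀ x → f (g x) ≡ x) →
                   (l : List A) → List.map f (List.map g l) ≡ l
List-map-inverse fg List.[]       = refl
List-map-inverse fg (x List.∷ l) = cong₂ List._∷_ (fg x) (List-map-inverse fg l)

record _≅_ {L : Language} (M M' : Structure L) : Set where
  field
    to            : Carrier M → Carrier M'
    to-injective  : ∀ {x y} → to x ≡ to y → x ≡ y
    to-surjective : ∀ y → ∃ λ x → to x ≡ y
    to-fn  : ∀ {m} (f : Fn L m) v → to (fn M f v) ≡ fn M' f (map to v)
    to-rl  : ∀ {m} (r : Rl L m) v → rl M r v → rl M' r (map to v)
    to-rl⁻ : ∀ {m} (r : Rl L m) v → rl M' r (map to v) → rl M r v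

  from : Carrier M' → Carrier M
  from y = proj₁ (to-surjective y)

  to-from : ∀ y → to (from y) ≡ y
  to-from y = proj₂ (to-surjective y)

  from-to : ∀ x → from (to x) ≡ x
  from-to x = to-injective (to-from (to x))

module _ {L : Language} {M M' : Structure L} (ι : M ≅ M') where
  open _≅_ ι

  mutual
    evalT-to : ∀ {n} (t : Term L n) v → to (evalT M t v) ≡ evalT M' t (map to v)
    evalT-to (var i)    v = sym (VecP.lookup-map i to v)
    evalT-to (app f ts) v = trans (to-fn f _) (cong (fn M' f) (evalTs-to ts v))

    evalTs-to : ∀ {n m} (ts : Vec (Term L n) m) v → map to (evalTs M ts v) ≡ evalTs M' ts (map to v)
    evalTs-to []       v = refl
    evalTs-to (t ∷ ts) v = cong₂ _∷_ (evalT-to t v) (evalTs-to ts v)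

  mutual
    Sat-to : ∀ {n} (φ : Formula L n) v → Sat M φ v → Sat M' φ (map to v)
    Sat-to ⊥'         v ()
    Sat-to (s ≐ t)    v e = trans (sym (evalT-to s v)) (trans (cong to e) (evalT-to t v))
    Sat-to (rel r ts) v x = subst (rl M' r) (evalTs-to ts v) (to-rl r _ x)
    Sat-to (¬' φ)     v x y = x (Sat-from φ v y)
    Sat-to (φ ∧' ψ)   v (x , y) = Sat-to φ v x , Sat-to ψ v y
    Sat-to (φ ∨' ψ)   v (inj₁ x) = inj₁ (Sat-to φ v x)
    Sat-to (φ ∨' ψ)   v (inj₂ y) = inj₂ (Sat-to ψ v y)
    Sat-to (φ ⇒' ψ)   v x y = Sat-to ψ v (x (Sat-from φ v y))
    Sat-to (∃' φ)     v (a , x) = to a , Sat-to φ (a ∷ v) x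
    Sat-to (∀' φ)     v x a' with to-surjective a'
    ... | a , refl = Sat-to φ (a ∷ v) (x a)

    Sat-from : ∀ {n} (φ : Formula L n) v → Sat M' φ (map to v) → Sat M φ v
    Sat-from ⊥'         v ()
    Sat-from (s ≐ t)    v e = to-injective (trans (evalT-to s v) (trans e (sym (evalT-to t v))))
    Sat-from (rel r ts) v x = to-rl⁻ r _ (subst (rl M' r) (sym (evalTs-to ts v)) x)
    Sat-from (¬' φ)     v x y = x (Sat-to φ v y)
    Sat-from (φ ∧' ψ)   v (x , y) = Sat-from φ v x , Sat-from ψ v y
    Sat-from (φ ∨' ψ)   v (inj₁ x) = inj₁ (Sat-from φ v x)
    Sat-from (φ ∨' ψ)   v (inj₂ y) = inj₂ (Sat-from ψ v y)
    Sat-from (φ ⇒' ψ)   v x y = Sat-from ψ v (x (Sat-to φ v y))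
    Sat-from (∃' φ)     v (a' , x) with to-surjective a'
    ... | a , refl = a , Sat-from φ (a ∷ v) x
    Sat-from (∀' φ)     v x a = Sat-from φ (a ∷ v) (x (to a))

  ≅-sym : M' ≅ M
  ≅-sym = record
    { to            = from
    ; to-injective  = λ {x} {y} e → trans (sym (to-from x)) (trans (cong to e) (to-from y))
    ; to-surjective = λ x → to x , from-to x
    ; to-fn  = λ f v → to-injective (begin
        to (from (fn M' f v))           ≡⟨ to-from _ ⟩
        fn M' f v                       ≡⟨ cong (fn M' f) (map-inverse to-from v) ⟨
        fn M' f (map to (map from v))   ≡⟨ to-fn f (map from v) ⟨
        to (fn M f (map from v))        ∎)
    ; to-rl  = λ r v x → to-rl⁻ r (map from v) (subst (rl M' r) (sym (map-inverse to-from v)) x)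
    ; to-rl⁻ = λ r v x → subst (rl M' r) (map-inverse to-from v) (to-rl r (map from v) x)
    }
    where open ≡-Reasoning

module _ {L : Language} (N : Structure L) where

  SameType : ∀ {n} → Vec (Carrier N) n → Vec (Carrier N) n → Set
  SameType u u' = ∀ φ → (Sat N φ u → Sat N φ u') × (Sat N φ u' → Sat N φ u)

  SameType-sym : ∀ {n} {u u' : Vec (Carrier N) n} → SameType u u' → SameType u' u
  SameType-sym same φ = proj₂ (same φ) , proj₁ (same φ)

  Isolates⇒SameType : ExcludedMiddle (lsuc 0ℓ) → ∀ {n} {φ : Formula L n} {e d} →
                      Notions.Isolates N φ e → Sat N φ d → SameType e d
  Isolates⇒SameType lem {φ = φ} {e} {d} (_ , isolates) φ[d] ψ = (λ ψ[e] → isolates ψ ψ[e] d φ[d]) , back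
    where
    back : Sat N ψ d → Sat N ψ e
    back ψ[d] with decide lem (Sat N ψ e)
    ... | yes ψ[e] = ψ[e]
    ... | no ¬ψ[e] = ⊥-elim (isolates (¬' ψ) ¬ψ[e] d φ[d] ψ[d])

data ++-Index (n m : ℕ) : Fin (n + m) → Set where
  inˡ : (i : Fin n) → ++-Index n m (i ↑ˡ m)
  inʳ : (j : Fin m) → ++-Index n m (n ↑ʳ j)

++-index : ∀ n {m} (t : Fin (n + m)) → ++-Index n m t
++-index n t with Fin.splitAt n t in eq
... | inj₁ i = subst (++-Index n _) (FinP.splitAt⁻¹-↑ˡ eq) (inˡ i)
... | inj₂ j = subst (++-Index n _) (FinP.splitAt⁻¹-↑ʳ eq) (inʳ j)

↑ˡ≢↑ʳ : ∀ n {m} (i : Fin n) (j : Fin m) → i ↑ˡ m ≢ n ↑ʳ j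
↑ˡ≢↑ʳ n {m} i j e with trans (sym (FinP.splitAt-↑ˡ n i m)) (trans (cong (Fin.splitAt n) e) (FinP.splitAt-↑ʳ n m j))
... | ()

⊆-++-lub : ∀ {A : Set} (xs : List A) {ys zs} → xs ⊆ zs → ys ⊆ zs → xs List.++ ys ⊆ zs
⊆-++-lub xs xs⊆zs ys⊆zs x∈ with ∈-++⁻ xs x∈
... | inj₁ x∈xs = xs⊆zs x∈xs
... | inj₂ x∈ys = ys⊆zs x∈ys

⊆-++ˡ : ∀ {A : Set} {xs} (ys : List A) {zs} → xs ⊆ ys → xs ⊆ ys List.++ zs
⊆-++ˡ ys xs⊆ys = ∈-++⁺ˡ ∘ xs⊆ys

⊆-++ʳ : ∀ {A : Set} {xs} (ys : List A) {zs} → xs ⊆ zs → xs ⊆ ys List.++ zs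
⊆-++ʳ ys xs⊆zs = ∈-++⁺ʳ ys ∘ xs⊆zs

++-swap⊆ : ∀ {A : Set} (xs ys : List A) → xs List.++ ys ⊆ ys List.++ xs
++-swap⊆ xs ys = ⊆-++-lub xs (⊆-++ʳ ys ⊆-refl) (⊆-++ˡ ys ⊆-refl)

concat-injective : ∀ {A : Set} {k n} (xs ys : Vec (Vec A k) n) → concat xs ≡ concat ys → xs ≡ ys
concat-injective []       []       _ = refl
concat-injective (x ∷ xs) (y ∷ ys) e =
  let x≡y , e' = VecP.++-injective x y e in cong₂ _∷_ x≡y (concat-injective xs ys e')

map-++-injective : ∀ {A : Set} (f : A → A) {n m} (u : Vec A n) (v : Vec A m) {u' v'} →
                   map f (u ++ v) ≡ u' ++ v' → map f u ≡ u' × map f v ≡ v'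
map-++-injective f u v {u'} e = VecP.++-injective (map f u) u' (trans (sym (VecP.map-++ f u v)) e)

map-fixes-∈ : ∀ {A : Set} {f : A → A} {n} (v : Vec A n) → map f v ≡ v → ∀ {x} → x ∈ toList v → f x ≡ x
map-fixes-∈ (y ∷ v) e (here refl) = VecP.∷-injectiveˡ e
map-fixes-∈ (y ∷ v) e (there x∈) = map-fixes-∈ v (VecP.∷-injectiveʳ e) x∈

module _ {L : Language} {N : Structure L} where
  open Notions N
  open _≅_

  private
    A = Carrier N

    member : ∀ {k n} → Vec (Vec A k) n → Fin n → List A
    member cs i = toList (lookup cs i)

  InPcl-mono : ∀ {d d' a a' : List A} → d' ⊆ d → a ⊆ a' → InPcl d a → InPcl d' a'
  InPcl-mono d'⊆d a⊆a' d∈pcl P P-elem = All-resp-⊇ d'⊆d ∘ d∈pcl P P-elem ∘ All-resp-⊇ a⊆a'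

  -- The summands of `others` are local to its definition, so they are found here by unification.
  ∈-concat-allFin⁺ : ∀ {n} {p : Fin n → List A} {l} → l ≡ List.concat (List.map p (List.allFin n)) →
                     ∀ j {x} → x ∈ p j → x ∈ l
  ∈-concat-allFin⁺ refl j x∈ = ∈-concat⁺′ x∈ (∈-map⁺ _ (∈-allFin j))

  ∈-concat-allFin⁻ : ∀ {n} {p : Fin n → List A} {l} → l ≡ List.concat (List.map p (List.allFin n)) →
                     ∀ {x} → x ∈ l → ∃ λ j → x ∈ p j
  ∈-concat-allFin⁻ {n} {p} refl x∈ with ∈-concat⁻′ (List.map p (List.allFin n)) x∈
  ... | _ , x∈xs , xs∈ with ∈-map⁻ p xs∈
  ...   | j , _ , refl = j , x∈xs

  ∈-others⁺ : ∀ {k n} (cs : Vec (Vec A k) n) {i j x} → j ≢ i → x ∈ member cs j → x ∈ others cs i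
  ∈-others⁺ cs {i} {j} j≢i x∈ with ∈-concat-allFin⁺ {l = others cs i} refl j
  ... | into with j ≟ i
  ...   | yes j≡i = ⊥-elim (j≢i j≡i)
  ...   | no _    = into x∈

  ∈-others⁻ : ∀ {k n} (cs : Vec (Vec A k) n) {i x} → x ∈ others cs i → ∃ λ j → j ≢ i × x ∈ member cs j
  ∈-others⁻ cs {i} x∈ with ∈-concat-allFin⁻ {l = others cs i} refl x∈
  ... | j , x∈pⱼ with j ≟ i
  ...   | no j≢i = j , j≢i , x∈pⱼ

  ∈-flat⁺ : ∀ {k n} (cs : Vec (Vec A k) n) j {x} → x ∈ member cs j → x ∈ flat cs
  ∈-flat⁺ (c ∷ cs) j x∈ rewrite VecP.toList-++ c (concat cs) with j
  ... | Fin.zero  = ∈-++⁺ˡ x∈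
  ... | Fin.suc j = ∈-++⁺ʳ (toList c) (∈-flat⁺ cs j x∈)

  ∈-flat⁻ : ∀ {k n} (cs : Vec (Vec A k) n) {x} → x ∈ flat cs → ∃ λ j → x ∈ member cs j
  ∈-flat⁻ (c ∷ cs) x∈ rewrite VecP.toList-++ c (concat cs) with ∈-++⁻ (toList c) x∈
  ... | inj₁ x∈c  = Fin.zero , x∈c
  ... | inj₂ x∈cs = let j , x∈cⱼ = ∈-flat⁻ cs x∈cs in Fin.suc j , x∈cⱼ

  others⊆flat : ∀ {k n} (cs : Vec (Vec A k) n) i → others cs i ⊆ flat cs
  others⊆flat cs i x∈ = let j , _ , x∈cⱼ = ∈-others⁻ cs x∈ in ∈-flat⁺ cs j x∈cⱼ

  module _ {k n m} (xs : Vec (Vec A k) n) (ys : Vec (Vec A k) m) where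

    member-↑ˡ : ∀ i → member (xs ++ ys) (i ↑ˡ m) ≡ member xs i
    member-↑ˡ i = cong toList (VecP.lookup-++ˡ xs ys i)

    member-↑ʳ : ∀ j → member (xs ++ ys) (n ↑ʳ j) ≡ member ys j
    member-↑ʳ j = cong toList (VecP.lookup-++ʳ xs ys j)

    others-↑ˡ : ∀ i → others (xs ++ ys) (i ↑ˡ m) ⊆ others xs i List.++ flat ys
    others-↑ˡ i x∈ with ∈-others⁻ (xs ++ ys) x∈
    ... | t , t≢ , x∈t with ++-index n t
    ...   | inˡ i' = ∈-++⁺ˡ (∈-others⁺ xs (t≢ ∘ cong (_↑ˡ m)) (subst (_ ∈_) (member-↑ˡ i') x∈t))
    ...   | inʳ j  = ∈-++⁺ʳ (others xs i) (∈-flat⁺ ys j (subst (_ ∈_) (member-↑ʳ j) x∈t))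

    others-↑ʳ : ∀ j → others (xs ++ ys) (n ↑ʳ j) ⊆ flat xs List.++ others ys j
    others-↑ʳ j x∈ with ∈-others⁻ (xs ++ ys) x∈
    ... | t , t≢ , x∈t with ++-index n t
    ...   | inˡ i  = ∈-++⁺ˡ (∈-flat⁺ xs i (subst (_ ∈_) (member-↑ˡ i) x∈t))
    ...   | inʳ j' = ∈-++⁺ʳ (flat xs) (∈-others⁺ ys (t≢ ∘ cong (n ↑ʳ_)) (subst (_ ∈_) (member-↑ʳ j') x∈t))

    ⊆-others-↑ˡ : ∀ i → others xs i List.++ flat ys ⊆ others (xs ++ ys) (i ↑ˡ m)
    ⊆-others-↑ˡ i = ⊆-++-lub (others xs i)
      (λ x∈ → let i' , i'≢i , x∈i' = ∈-others⁻ xs x∈ in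
        ∈-others⁺ (xs ++ ys) (i'≢i ∘ FinP.↑ˡ-injective m i' i) (subst (_ ∈_) (sym (member-↑ˡ i')) x∈i'))
      (λ x∈ → let j , x∈j = ∈-flat⁻ ys x∈ in
        ∈-others⁺ (xs ++ ys) (↑ˡ≢↑ʳ n i j ∘ sym) (subst (_ ∈_) (sym (member-↑ʳ j)) x∈j))

    ⊆-others-↑ʳ : ∀ j → flat xs List.++ others ys j ⊆ others (xs ++ ys) (n ↑ʳ j)
    ⊆-others-↑ʳ j = ⊆-++-lub (flat xs)
      (λ x∈ → let i , x∈i = ∈-flat⁻ xs x∈ in
        ∈-others⁺ (xs ++ ys) (↑ˡ≢↑ʳ n i j) (subst (_ ∈_) (sym (member-↑ˡ i)) x∈i))
      (λ x∈ → let j' , j'≢j , x∈j' = ∈-others⁻ ys x∈ in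
        ∈-others⁺ (xs ++ ys) (j'≢j ∘ FinP.↑ʳ-injective n j' j) (subst (_ ∈_) (sym (member-↑ʳ j')) x∈j'))

    Indep-++⁻ : ∀ {a} → Indep (xs ++ ys) a →
      (∀ i → ¬ InPcl (member xs i) (a List.++ others xs i List.++ flat ys)) ×
      (∀ j → ¬ InPcl (member ys j) (a List.++ flat xs List.++ others ys j))
    Indep-++⁻ {a} indep =
      (λ i → indep (i ↑ˡ m) ∘ InPcl-mono (⊆-reflexive (member-↑ˡ i)) (++⁺ʳ a (⊆-others-↑ˡ i))) ,
      (λ j → indep (n ↑ʳ j) ∘ InPcl-mono (⊆-reflexive (member-↑ʳ j)) (++⁺ʳ a (⊆-others-↑ʳ j)))

    Indep-++⁺ : ∀ {a} →
      (∀ i → ¬ InPcl (member xs i) (a List.++ others xs i List.++ flat ys)) →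
      (∀ j → ¬ InPcl (member ys j) (a List.++ flat xs List.++ others ys j)) →
      Indep (xs ++ ys) a
    Indep-++⁺ {a} indepˡ indepʳ t with ++-index n t
    ... | inˡ i = indepˡ i ∘ InPcl-mono (⊆-reflexive (sym (member-↑ˡ i))) (++⁺ʳ a (others-↑ˡ i))
    ... | inʳ j = indepʳ j ∘ InPcl-mono (⊆-reflexive (sym (member-↑ʳ j))) (++⁺ʳ a (others-↑ʳ j))

  Indep-++-comm : ∀ {k n m} (xs : Vec (Vec A k) n) (ys : Vec (Vec A k) m) {a} →
                  Indep (xs ++ ys) a → Indep (ys ++ xs) a
  Indep-++-comm xs ys {a} indep = Indep-++⁺ ys xs
    (λ j → proj₂ (Indep-++⁻ xs ys indep) j ∘ InPcl-mono ⊆-refl (++⁺ʳ a (++-swap⊆ (others ys j) (flat xs))))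
    (λ i → proj₁ (Indep-++⁻ xs ys indep) i ∘ InPcl-mono ⊆-refl (++⁺ʳ a (++-swap⊆ (flat ys) (others xs i))))


  module _ (lem : ExcludedMiddle (lsuc 0ℓ)) where

    IsElemSub⇒proj₁-injective : ∀ {P} → IsElemSub P → ∀ {s t : Σ A P} → proj₁ s ≡ proj₁ t → s ≡ t
    IsElemSub⇒proj₁-injective (_ , elem) {s} {t} =
      proj₂ (elem (var Fin.zero ≐ var (Fin.suc Fin.zero)) (s ∷ t ∷ []))

    IsElemSub-∘ : (α : N ≅ N) → ∀ {P} → IsElemSub P → IsElemSub (λ x → P (to α x))
    IsElemSub-∘ α {P} P-elem@(cl , elem) = cl' , elem'
      where
      -- α restricts to an isomorphism ι from the substructure on P ∘ α onto the one on P.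
      P' : A → Set
      P' x = P (to α x)

      cl' : ClosedUnderFns N P'
      cl' f v pv = subst P (sym (to-fn α f v)) (cl f (map (to α) v) (VAllP.map⁺ pv))

      sub' sub : Structure L
      sub' = subStructure N P' cl'
      sub  = subStructure N P cl

      g : Σ A P' → Σ A P
      g (x , p) = to α x , p

      map-proj₁-g : ∀ {n} (v : Vec (Σ A P') n) → map proj₁ (map g v) ≡ map (to α) (map proj₁ v)
      map-proj₁-g v = trans (sym (VecP.map-∘ proj₁ g v)) (VecP.map-∘ (to α) proj₁ v)

      -- The carrier has UIP by Hedberg, its equality being decidable by excluded middle.
      g-injective : ∀ {s t} → g s ≡ g t → s ≡ t
      g-injective {x , p} {y , q} e with to-injective α (cong proj₁ e)
      ... | refl = cong (x ,_) (,-injectiveʳ-UIP (Decidable⇒UIP.≡-irrelevant (λ a b → decide lem (a ≡ b))) e)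

      ι : sub' ≅ sub
      ι = record
        { to            = g
        ; to-injective  = g-injective
        ; to-surjective = λ (y , q) →
            (from α y , subst P (sym (to-from α y)) q) , IsElemSub⇒proj₁-injective P-elem (to-from α y)
        ; to-fn  = λ f v → IsElemSub⇒proj₁-injective P-elem
                     (trans (to-fn α f (map proj₁ v)) (cong (fn N f) (sym (map-proj₁-g v))))
        ; to-rl  = λ r v x → subst (rl N r) (sym (map-proj₁-g v)) (to-rl α r _ x)
        ; to-rl⁻ = λ r v x → to-rl⁻ α r _ (subst (rl N r) (map-proj₁-g v) x)
        }

      elem' : ∀ {n} (φ : Formula L n) (v : Vec (Σ A P') n) →
              (Sat sub' φ v → Sat N φ (map proj₁ v)) × (Sat N φ (map proj₁ v) → Sat sub' φ v)
      elem' φ v =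
        (λ s → Sat-from α φ _ (subst (Sat N φ) (map-proj₁-g v) (proj₁ (elem φ (map g v)) (Sat-to ι φ v s)))) ,
        (λ s → Sat-from ι φ v (proj₂ (elem φ (map g v)) (subst (Sat N φ) (sym (map-proj₁-g v)) (Sat-to α φ _ s))))

    InPcl-map : (α : N ≅ N) → ∀ {d a} → InPcl d a → InPcl (List.map (to α) d) (List.map (to α) a)
    InPcl-map α d∈pcl P P-elem a⊆P =
      LAllP.map⁺ (d∈pcl (λ x → P (to α x)) (IsElemSub-∘ α P-elem) (LAllP.map⁻ a⊆P))

    member-map : (f : A → A) → ∀ {k n} (cs : Vec (Vec A k) n) i → member (map (map f) cs) i ≡ List.map f (member cs i)
    member-map f cs i = trans (cong toList (VecP.lookup-map i (map f) cs)) (VecP.toList-map f (lookup cs i))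

    flat-map : (f : A → A) → ∀ {k n} (cs : Vec (Vec A k) n) → flat (map (map f) cs) ≡ List.map f (flat cs)
    flat-map f cs = trans (cong toList (sym (VecP.map-concat f cs))) (VecP.toList-map f (concat cs))

    others-map : (f : A → A) → ∀ {k n} (cs : Vec (Vec A k) n) i → others (map (map f) cs) i ⊆ List.map f (others cs i)
    others-map f cs i x∈ with ∈-others⁻ (map (map f) cs) x∈
    ... | j , j≢i , x∈ⱼ with ∈-map⁻ f (subst (_ ∈_) (member-map f cs j) x∈ⱼ)
    ...   | y , y∈ⱼ , refl = ∈-map⁺ f (∈-others⁺ cs j≢i y∈ⱼ)

    InPcl-map⁻ : (α : N ≅ N) → ∀ {d a} → InPcl (List.map (to α) d) (List.map (to α) a) → InPcl d a
    InPcl-map⁻ α {d} {a} pcl =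
      subst₂ InPcl (List-map-inverse (from-to α) d) (List-map-inverse (from-to α) a) (InPcl-map (≅-sym α) pcl)

    Indep-map : (α : N ≅ N) → ∀ {k n} (cs : Vec (Vec A k) n) {a} → Indep cs a → Indep (map (map (to α)) cs) (List.map (to α) a)
    Indep-map α cs {a} indep i pcl = indep i (InPcl-map⁻ α (InPcl-mono d⊆ a⊆ pcl))
      where
      d⊆ : List.map (to α) (member cs i) ⊆ member (map (map (to α)) cs) i
      d⊆ = ⊆-reflexive (sym (member-map (to α) cs i))
      a⊆ : List.map (to α) a List.++ others (map (map (to α)) cs) i ⊆ List.map (to α) (a List.++ others cs i)
      a⊆ = ⊆-trans (++⁺ʳ _ (others-map (to α) cs i)) (⊆-reflexive (sym (ListP.map-++ (to α) a (others cs i))))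

    Exchange : List A → Set₁
    Exchange d = ∀ B c → InPcl c (B List.++ d) → ¬ InPcl c B → InPcl d (B List.++ c)

    Exchange-map : (α : N ≅ N) → ∀ {d} → Exchange d → Exchange (List.map (to α) d)
    Exchange-map α {d} exchange B c pcl ¬pcl = subst₂ InPcl refl to-from-B++c (InPcl-map α pcl')
      where
      β = ≅-sym α
      from-B++d : List.map (from α) (B List.++ List.map (to α) d) ≡ List.map (from α) B List.++ d
      from-B++d = trans (ListP.map-++ (from α) B _) (cong (_ List.++_) (List-map-inverse (from-to α) d))
      to-from-B++c : List.map (to α) (List.map (from α) B List.++ List.map (from α) c) ≡ B List.++ c
      to-from-B++c = trans (ListP.map-++ (to α) (List.map (from α) B) (List.map (from α) c))
                           (cong₂ List._++_ (List-map-inverse (to-from α) B) (List-map-inverse (to-from α) c))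
      pcl' : InPcl d (List.map (from α) B List.++ List.map (from α) c)
      pcl' = exchange _ _ (subst₂ InPcl refl from-B++d (InPcl-map β pcl))
                           (¬pcl ∘ subst₂ InPcl (List-map-inverse (to-from α) c) (List-map-inverse (to-from α) B) ∘ InPcl-map α)

    exchange-tuple : ∀ {k m} (ds : Vec (Vec A k) m) → All (Exchange ∘ toList) ds →
                     ∀ B c → InPcl c (B List.++ flat ds) → ¬ InPcl c B →
                     ∃ λ j → InPcl (member ds j) (B List.++ c List.++ others ds j)
    exchange-tuple [] [] B c pcl ¬pcl = ⊥-elim (¬pcl (InPcl-mono ⊆-refl (⊆-reflexive (ListP.++-identityʳ B)) pcl))
    exchange-tuple (d ∷ ds) (exchange ∷ exchanges) B c pcl ¬pcl with lem {InPcl c (B List.++ flat ds)}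
    ... | yes pcl-ds =
      let j , pclⱼ = exchange-tuple ds exchanges B c pcl-ds ¬pcl
      in Fin.suc j , InPcl-mono ⊆-refl (++⁺ʳ B (++⁺ʳ c others-suc)) pclⱼ
      where
      others-suc : ∀ {j} → others ds j ⊆ others (d ∷ ds) (Fin.suc j)
      others-suc x∈ = let j' , j'≢j , x∈j' = ∈-others⁻ ds x∈ in
        ∈-others⁺ (d ∷ ds) (j'≢j ∘ FinP.suc-injective) x∈j'
    ... | no ¬pcl-ds =
      Fin.zero , InPcl-mono ⊆-refl B++ds++c⊆ (exchange (B List.++ flat ds) c (InPcl-mono ⊆-refl B++d++ds⊆ pcl) ¬pcl-ds)
      where
      flat-∷ : flat (d ∷ ds) ≡ toList d List.++ flat ds
      flat-∷ = VecP.toList-++ d (concat ds)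
      B++d++ds⊆ : B List.++ flat (d ∷ ds) ⊆ (B List.++ flat ds) List.++ toList d
      B++d++ds⊆ = ⊆-trans (++⁺ʳ B (⊆-reflexive flat-∷))
        (⊆-++-lub B (⊆-++ˡ (B List.++ flat ds) (⊆-++ˡ B ⊆-refl))
                    (⊆-++-lub (toList d) (⊆-++ʳ (B List.++ flat ds) ⊆-refl)
                                         (⊆-++ˡ (B List.++ flat ds) (⊆-++ʳ B ⊆-refl))))
      flat-ds⊆others : flat ds ⊆ others (d ∷ ds) Fin.zero
      flat-ds⊆others x∈ = let j , x∈ⱼ = ∈-flat⁻ ds x∈ in ∈-others⁺ (d ∷ ds) {i = Fin.zero} {j = Fin.suc j} (λ ()) x∈ⱼ
      B++ds++c⊆ : (B List.++ flat ds) List.++ c ⊆ B List.++ c List.++ others (d ∷ ds) Fin.zero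
      B++ds++c⊆ = ⊆-++-lub (B List.++ flat ds)
        (⊆-++-lub B (⊆-++ˡ B ⊆-refl) (⊆-++ʳ B (⊆-++ʳ c flat-ds⊆others)))
        (⊆-++ʳ B (⊆-++ˡ c ⊆-refl))

    Indep-++-tower : ∀ {k n m} (xs : Vec (Vec A k) n) (ys : Vec (Vec A k) m) {X} →
                     All (Exchange ∘ toList) xs → Indep ys X → Indep xs (flat ys List.++ X) → Indep (xs ++ ys) X
    Indep-++-tower xs ys {X} exchanges indep-ys indep-xs = Indep-++⁺ xs ys indepˡ indepʳ
      where
      indepˡ : ∀ i → ¬ InPcl (member xs i) (X List.++ others xs i List.++ flat ys)
      indepˡ i = indep-xs i ∘ InPcl-mono ⊆-refl
        (⊆-++-lub X (⊆-++ˡ (flat ys List.++ X) (⊆-++ʳ (flat ys) ⊆-refl))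
                    (⊆-++-lub (others xs i) (⊆-++ʳ (flat ys List.++ X) ⊆-refl)
                                            (⊆-++ˡ (flat ys List.++ X) (⊆-++ˡ (flat ys) ⊆-refl))))

      X++xs++ysⱼ⊆ : ∀ {j} → X List.++ flat xs List.++ others ys j ⊆ (X List.++ others ys j) List.++ flat xs
      X++xs++ysⱼ⊆ {j} = ⊆-++-lub X (⊆-++ˡ (X List.++ others ys j) (⊆-++ˡ X ⊆-refl))
        (⊆-++-lub (flat xs) (⊆-++ʳ (X List.++ others ys j) ⊆-refl)
                            (⊆-++ˡ (X List.++ others ys j) (⊆-++ʳ X ⊆-refl)))

      -- By exchange, a dependence of ys_j on xs would make some xs_l depend on ys.
      indepʳ : ∀ j → ¬ InPcl (member ys j) (X List.++ flat xs List.++ others ys j)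
      indepʳ j pcl with exchange-tuple xs exchanges (X List.++ others ys j) (member ys j)
                          (InPcl-mono ⊆-refl X++xs++ysⱼ⊆ pcl)
                          (indep-ys j)
      ... | l , pclₗ = indep-xs l (InPcl-mono ⊆-refl ⊆ys++X++xsₗ pclₗ)
        where
        Y = flat ys List.++ X
        ⊆ys++X++xsₗ : (X List.++ others ys j) List.++ member ys j List.++ others xs l ⊆ Y List.++ others xs l
        ⊆ys++X++xsₗ = ⊆-++-lub (X List.++ others ys j)
          (⊆-++-lub X (⊆-++ˡ Y (⊆-++ʳ (flat ys) ⊆-refl)) (⊆-++ˡ Y (⊆-++ˡ (flat ys) (others⊆flat ys j))))
          (⊆-++-lub (member ys j) (⊆-++ˡ Y (⊆-++ˡ (flat ys) (∈-flat⁺ ys j))) (⊆-++ʳ Y ⊆-refl))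

    module _ (countable : Countable) (atomic : Atomic) where

      forth : ∀ {n} {u u' : Vec A n} → SameType N u u' → (x : A) → ∃ λ x' → SameType N (x ∷ u) (x' ∷ u')
      forth {u = u} same x with atomic (x ∷ u)
      ... | φ , isolates with proj₁ (same (∃' φ)) (x , proj₁ isolates)
      ... | x' , φ[x'u'] = x' , Isolates⇒SameType N lem {φ = φ} isolates φ[x'u']

      record PartialIso : Set where
        constructor partialIso
        field
          {size}      : ℕ
          left right  : Vec A size
          same        : SameType N left right

      -- x receives an image x' (position 1) and a preimage y (position 0); σ and τ read these off.
      back-and-forth : PartialIso → A → PartialIso
      back-and-forth (partialIso u u' same) x =
        partialIso (y ∷ x ∷ u) (x ∷ x' ∷ u') (SameType-sym N same'')
        where
        x' = proj₁ (forth same x)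
        same' = proj₂ (forth same x)
        y = proj₁ (forth (SameType-sym N same') x)
        same'' = proj₂ (forth (SameType-sym N same') x)

      module Limit {n} (u₀ u₀' : Vec A n) (same₀ : SameType N u₀ u₀') where
        open PartialIso

        enum : ℕ → A
        enum = proj₁ countable

        index : A → ℕ
        index z = proj₁ (proj₂ countable z)

        enum-index : ∀ z → enum (index z) ≡ z
        enum-index z = proj₂ (proj₂ countable z) refl

        stage : ℕ → PartialIso
        stage zero    = partialIso u₀ u₀' same₀
        stage (suc k) = back-and-forth (stage k) (enum k)

        record Paired (k : ℕ) (z w : A) : Set where
          constructor paired
          field
            position : Fin (size (stage k))
            left≡    : lookup (left (stage k)) position ≡ z
            right≡   : lookup (right (stage k)) position ≡ w

        Paired-mono : ∀ {k K z w} → k ≤′ K → Paired k z w → Paired K z w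
        Paired-mono (≤′-reflexive refl) p           = p
        Paired-mono (≤′-step k≤K)       p with Paired-mono k≤K p
        ... | paired i eˡ eʳ = paired (Fin.suc (Fin.suc i)) eˡ eʳ

        Paired-functional : ∀ {k k' z w w'} → Paired k z w → Paired k' z w' → w ≡ w'
        Paired-functional {k} {k'} p q with Paired-mono (≤⇒≤′ (m≤m⊔n k k')) p | Paired-mono (≤⇒≤′ (m≤n⊔m k k')) q
        ... | paired i eˡ eʳ | paired j fˡ fʳ =
          trans (sym eʳ) (trans (proj₁ (same (stage (k ⊔ k')) (var i ≐ var j)) (trans eˡ (sym fˡ))) fʳ)

        Paired-injective : ∀ {k k' z z' w} → Paired k z w → Paired k' z' w → z ≡ z'
        Paired-injective {k} {k'} p q with Paired-mono (≤⇒≤′ (m≤m⊔n k k')) p | Paired-mono (≤⇒≤′ (m≤n⊔m k k')) q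
        ... | paired i eˡ eʳ | paired j fˡ fʳ =
          trans (sym eˡ) (trans (proj₂ (same (stage (k ⊔ k')) (var i ≐ var j)) (trans eʳ (sym fʳ))) fˡ)

        σ τ : A → A
        σ z = lookup (right (stage (suc (index z)))) (Fin.suc Fin.zero)
        τ z = lookup (left (stage (suc (index z)))) Fin.zero

        Paired-σ : ∀ z → Paired (suc (index z)) z (σ z)
        Paired-σ z = paired (Fin.suc Fin.zero) (enum-index z) refl

        Paired-τ : ∀ z → Paired (suc (index z)) (τ z) z
        Paired-τ z = paired Fin.zero refl (enum-index z)

        σ-unique : ∀ {k z w} → Paired k z w → σ z ≡ w
        σ-unique = Paired-functional (Paired-σ _)

        σ-injective : ∀ {x y} → σ x ≡ σ y → x ≡ y
        σ-injective {x} {y} e = Paired-injective (Paired-σ x) (subst (Paired _ y) (sym e) (Paired-σ y))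

        σ-τ : ∀ z → σ (τ z) ≡ z
        σ-τ z = σ-unique (Paired-τ z)

        PairedVec : ℕ → ∀ {m} → Vec A m → Vec A m → Set
        PairedVec k v w = ∃ λ is → map (lookup (left (stage k))) is ≡ v × map (lookup (right (stage k))) is ≡ w

        PairedVec-mono : ∀ {k K m} {v w : Vec A m} → k ≤′ K → PairedVec k v w → PairedVec K v w
        PairedVec-mono {v = []}    {[]}    k≤K _ = [] , refl , refl
        PairedVec-mono {v = _ ∷ _} {_ ∷ _} k≤K (i ∷ is , eˡ , eʳ)
          with Paired-mono k≤K (paired i (VecP.∷-injectiveˡ eˡ) (VecP.∷-injectiveˡ eʳ))
             | PairedVec-mono k≤K (is , VecP.∷-injectiveʳ eˡ , VecP.∷-injectiveʳ eʳ)
        ... | paired j fˡ fʳ | js , gˡ , gʳ = j ∷ js , cong₂ _∷_ fˡ gˡ , cong₂ _∷_ fʳ gʳ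

        PairedVec-σ : ∀ {m} (v : Vec A m) → ∃ λ k → PairedVec k v (map σ v)
        PairedVec-σ []      = zero , [] , refl , refl
        PairedVec-σ (x ∷ v) with PairedVec-σ v
        ... | k , pv with Paired-mono (≤⇒≤′ (m≤n⊔m k (suc (index x)))) (Paired-σ x)
                        | PairedVec-mono (≤⇒≤′ (m≤m⊔n k (suc (index x)))) pv
        ... | paired i eˡ eʳ | is , fˡ , fʳ = k ⊔ suc (index x) , i ∷ is , cong₂ _∷_ eˡ fˡ , cong₂ _∷_ eʳ fʳ

        evalTs-vars : ∀ {n m} (is : Vec (Fin n) m) (u : Vec A n) → evalTs N (map var is) u ≡ map (lookup u) is
        evalTs-vars []       u = refl
        evalTs-vars (i ∷ is) u = cong (lookup u i ∷_) (evalTs-vars is u)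

        σ-fn : ∀ {m} (f : Fn L m) v → σ (fn N f v) ≡ fn N f (map σ v)
        σ-fn f v with PairedVec-σ (fn N f v ∷ v)
        ... | k , i ∷ is , eˡ , eʳ = begin
          σ (fn N f v)                                           ≡⟨ VecP.∷-injectiveˡ eʳ ⟨
          lookup (right (stage k)) i                             ≡⟨ proj₁ (same (stage k) φ) φ[left] ⟩
          fn N f (evalTs N (map var is) (right (stage k)))       ≡⟨ cong (fn N f) (evalTs-vars is _) ⟩
          fn N f (map (lookup (right (stage k))) is)             ≡⟨ cong (fn N f) (VecP.∷-injectiveʳ eʳ) ⟩
          fn N f (map σ v)                                       ∎
          where
          open ≡-Reasoning
          φ = var i ≐ app f (map var is)
          φ[left] : Sat N φ (left (stage k))
          φ[left] = trans (VecP.∷-injectiveˡ eˡ)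
                      (cong (fn N f) (sym (trans (evalTs-vars is _) (VecP.∷-injectiveʳ eˡ))))

        σ-rl : ∀ {m} (r : Rl L m) v → rl N r v → rl N r (map σ v)
        σ-rl r v x with PairedVec-σ v
        ... | k , is , eˡ , eʳ =
          subst (rl N r) (trans (evalTs-vars is _) eʳ)
            (proj₁ (same (stage k) (rel r (map var is))) (subst (rl N r) (sym (trans (evalTs-vars is _) eˡ)) x))

        σ-rl⁻ : ∀ {m} (r : Rl L m) v → rl N r (map σ v) → rl N r v
        σ-rl⁻ r v x with PairedVec-σ v
        ... | k , is , eˡ , eʳ =
          subst (rl N r) (trans (evalTs-vars is _) eˡ)
            (proj₂ (same (stage k) (rel r (map var is))) (subst (rl N r) (sym (trans (evalTs-vars is _) eʳ)) x))

        automorphism : N ≅ N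
        automorphism = record
          { to = σ ; to-injective = σ-injective ; to-surjective = λ z → τ z , σ-τ z
          ; to-fn = σ-fn ; to-rl = σ-rl ; to-rl⁻ = σ-rl⁻ }

        extends : map σ u₀ ≡ u₀'
        extends = go u₀ u₀' (λ i → σ-unique {k = 0} (paired i refl refl))
          where
          go : ∀ {m} (v w : Vec A m) → (∀ i → σ (lookup v i) ≡ lookup w i) → map σ v ≡ w
          go []      []      _ = refl
          go (x ∷ v) (y ∷ w) e = cong₂ _∷_ (e Fin.zero) (go v w (e ∘ Fin.suc))

      homogeneous : ∀ {n} {u u' : Vec A n} → SameType N u u' → Σ (N ≅ N) λ α → map (_≅_.to α) u ≡ u'
      homogeneous same = Limit.automorphism _ _ same , Limit.extends _ _ same

      θ-Exchange : ∀ {k} {θ : Formula L k} → CompletePseudoMinimal θ → ∀ {d} → Sat N θ d → Exchange (toList d)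
      θ-Exchange {θ = θ} (e , isolates , pseudo-minimal) {d} θ[d]
        with homogeneous (Isolates⇒SameType N lem {φ = θ} isolates θ[d])
      ... | α , αe≡d =
        subst Exchange (trans (sym (VecP.toList-map (to α) e)) (cong toList αe≡d)) (Exchange-map α (proj₂ pseudo-minimal))

      Dominates-map : (α : N ≅ N) → ∀ {k n lb lh} {θ : Formula L k} {cs : Vec (Vec A k) n} {b : Vec A lb} {h : Vec A lh} →
                      map (to α) h ≡ h → Dominates θ cs b h → Dominates θ (map (map (to α)) cs) (map (to α) b) h
      Dominates-map α {k} {θ = θ} {cs} {b} {h} αh≡h (indep , dominates) = indep' , dominates'
        where
        β = ≅-sym α

        indep' : Indep (map (map (to α)) cs) (toList h)
        indep' = subst (Indep _) (trans (sym (VecP.toList-map (to α) h)) (cong toList αh≡h)) (Indep-map α cs indep)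

        from-fixes-h : ∀ {x} → x ∈ toList h → from α x ≡ x
        from-fixes-h {x} x∈h = trans (cong (from α) (sym (map-fixes-∈ h αh≡h x∈h))) (from-to α x)

        dominates' : ∀ {m} (cs** : Vec (Vec A k) m) → Inθ θ cs** →
                     ∀ h** → (∀ {x} → x ∈ toList h → x ∈ h**) → Indep (map (map (to α)) cs ++ cs**) h** →
                     Indep cs** (h** List.++ flat (map (map (to α)) cs) List.++ toList (map (to α) b))
        dominates' cs** θ[cs**] h** h⊆h** indep** =
          subst₂ Indep (map-inverse (map-inverse (to-from α)) cs**) over-eq
            (Indep-map α ds (dominates ds θ[ds] (List.map (from α) h**) h⊆ indep-ds))
          where
          open ≡-Reasoning
          ds = map (map (from α)) cs**

          θ[ds] : Inθ θ ds
          θ[ds] = VAllP.map⁺ (VAll.map (λ {c} → Sat-to β θ c) θ[cs**])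

          h⊆ : ∀ {x} → x ∈ toList h → x ∈ List.map (from α) h**
          h⊆ x∈h = subst (_∈ _) (from-fixes-h x∈h) (∈-map⁺ (from α) (h⊆h** x∈h))

          indep-ds : Indep (cs ++ ds) (List.map (from α) h**)
          indep-ds = subst (λ E → Indep E _)
            (trans (VecP.map-++ (map (from α)) (map (map (to α)) cs) cs**)
                   (cong (_++ ds) (map-inverse (map-inverse (from-to α)) cs)))
            (Indep-map β _ indep**)

          over-eq : List.map (to α) (List.map (from α) h** List.++ flat cs List.++ toList b) ≡
                    h** List.++ flat (map (map (to α)) cs) List.++ toList (map (to α) b)
          over-eq = begin
            List.map (to α) (List.map (from α) h** List.++ flat cs List.++ toList b)
              ≡⟨ ListP.map-++ (to α) (List.map (from α) h**) _ ⟩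
            List.map (to α) (List.map (from α) h**) List.++ List.map (to α) (flat cs List.++ toList b)
              ≡⟨ cong₂ List._++_ (List-map-inverse (to-from α) h**) (ListP.map-++ (to α) (flat cs) (toList b)) ⟩
            h** List.++ List.map (to α) (flat cs) List.++ List.map (to α) (toList b)
              ≡⟨ cong (h** List.++_) (cong₂ List._++_ (sym (flat-map (to α) cs)) (sym (VecP.toList-map (to α) b))) ⟩
            h** List.++ flat (map (map (to α)) cs) List.++ toList (map (to α) b)
              ∎

      Dominates-SameTp : ∀ {k n lb lh} {θ : Formula L k} {cs cs' : Vec (Vec A k) n} {b b' : Vec A lb} {h : Vec A lh} →
                         SameTp (concat cs' ++ b') (concat cs ++ b) h → Dominates θ cs b h → Dominates θ cs' b' h
      -- SameTp d d' h is SameType (d ++ h) (d' ++ h) by definition.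
      Dominates-SameTp {θ = θ} {cs} {b = b} {h = h} same dominates
        with homogeneous (SameType-sym N same)
      ... | α , α[cs-b-h]≡cs'-b'-h
        with map-++-injective (to α) (concat cs ++ b) h α[cs-b-h]≡cs'-b'-h
      ... | α[cs-b]≡cs'-b' , αh≡h
        with map-++-injective (to α) (concat cs) b α[cs-b]≡cs'-b'
      ... | αcs≡cs' , αb≡b' =
        subst₂ (λ E c → Dominates θ E c h)
          (concat-injective _ _ (trans (sym (VecP.map-concat (to α) cs)) αcs≡cs')) αb≡b'
          (Dominates-map α {θ = θ} αh≡h dominates)

corollary4p5 : ExcludedMiddle (lsuc 0ℓ) →
    {L : Language} (N : Structure L) → let open Notions N in
    Countable → Atomic → NotMinimal → FinitelyRanked →
    ∀ {k} (θ : Formula L k) → CompletePseudoMinimal θ →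
    ∀ {n* n lb lh} (cs* : Vec (Vec (Carrier N) k) n*) (cs cs' : Vec (Vec (Carrier N) k) n)
    (b b' : Vec (Carrier N) lb) (h : Vec (Carrier N) lh) →
    Inθ θ cs* → Inθ θ cs → Inθ θ cs' →
    Dominates θ cs b h →
    Indep (cs* ++ cs) (toList h) →
    Indep cs' (flat cs* List.++ toList h List.++ flat cs List.++ toList b) →
    SameTp (concat cs' ++ b') (concat cs ++ b) h →
    Indep cs* (toList h List.++ flat cs List.++ toList b List.++ flat cs' List.++ toList b')
corollary4p5 lem N countable atomic _ _ θ θ-cpm cs* cs cs' b b' h
             θ[cs*] _ θ[cs'] dominates indep-cs*cs indep-cs' same =
  subst (Indep cs*) reassociate (proj₂ dominates' cs* θ[cs*] X ∈-++⁺ˡ indep-cs'cs*)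
  where
  open Notions N
  X = toList h List.++ flat cs List.++ toList b

  indep-cs* : Indep cs* X
  indep-cs* = proj₂ dominates cs* θ[cs*] (toList h) (λ x∈ → x∈) (Indep-++-comm cs* cs indep-cs*cs)

  indep-cs'cs* : Indep (cs' ++ cs*) X
  indep-cs'cs* = Indep-++-tower lem cs' cs* (VAll.map (θ-Exchange lem countable atomic {θ = θ} θ-cpm) θ[cs']) indep-cs* indep-cs'

  dominates' : Dominates θ cs' b' h
  dominates' = Dominates-SameTp lem countable atomic {θ = θ} same dominates

  reassociate : X List.++ flat cs' List.++ toList b' ≡ toList h List.++ flat cs List.++ toList b List.++ flat cs' List.++ toList b'
  reassociate = trans (ListP.++-assoc (toList h) _ _) (cong (toList h List.++_) (ListP.++-assoc (flat cs) (toList b) _))
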